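{- Let $S=[S(n,k)]_{n,k\ge0}$ and $C=[C(n,k)]_{n,k\ge0}$. Then $S=L_S\,\Lambda\,P^t$ and $C=L_C\,\Lambda\,P^t$, where $\Lambda=\mathrm{diag}(1,2,2^2,2^3,\dots)$, $P=[\binom{n}{k}]_{n,k\ge0}$ is the Pascal triangle and $P^t$ its transpose, $L_S$ is the lower triangular matrix with $(0,0)$ entry $1$, $(n,0)$ entry $0$ for $n\ge1$ and $(n,k)$ entry $\binom{n-1}{k-1}$ for $n\ge k\ge1$ (i.e. $L_S=\mathcal{R}(1,\frac{x}{1-x})$), and $L_C$ is the lower triangular matrix with $(n,k)$ entry $\binom{n}{k}+\binom{n-1}{k}$ for $n\ge k\ge0$, where $\binom{n-1}{k}$ is taken to be $0$ when $n=0$ (i.e. $L_C=\mathcal{R}(\frac{1+x}{1-x},\frac{x}{1-x})$).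
   Context: For $n,k\ge0$, $S(n,k)$ is the number of $(x_1,\dots,x_k)\in\mathbb{Z}^k$ with $|x_1|+\cdots+|x_k|=n$, and $C(n,k)=S(n,k+1)$. For formal power series $g,f$, the Riordan array $\mathcal{R}(g(x),f(x))$ is the infinite matrix whose $(n,k)$ entry is $[x^n]\,g(x)f(x)^k$. -}

module Defs where

open import Data.Nat using (ℕ; zero; suc; _+_; _*_; _^_; _≤?_; _≟_)
open import Data.Nat.Combinatorics using (_C_)
open import Data.Integer as ℤ using (ℤ; +_; -[1+_]; ∣_∣)
open import Data.List using (List; []; _∷_; map; concatMap; filterᵇ; length; upTo; reverse; _++_)
open import Data.Vec using (Vec; []; _∷_)
open import Data.Bool using (Bool; if_then_else_)
open import Relation.Nullary.Decidable using (⌊_⌋)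

Matrix : Set
Matrix = ℕ → ℕ → ℕ

range : ℕ → List ℤ
range n = map (λ i → ℤ.-_ (+ suc i)) (reverse (upTo n)) ++ map +_ (upTo (suc n))

box : ℕ → (k : ℕ) → List (Vec ℤ k)
box n zero = [] ∷ []
box n (suc k) = concatMap (λ x → map (x ∷_) (box n k)) (range n)

absSum : ∀ {k} → Vec ℤ k → ℕ
absSum [] = 0
absSum (x ∷ xs) = ∣ x ∣ + absSum xs

-- S(n,k) = #{ x ∈ ℤ^k : |x₁|+⋯+|x_k| = n }.  Every such x lies in [-n,n]^k,
-- so counting within the box counts all solutions.
S : Matrix
S n k = length (filterᵇ (λ v → ⌊ absSum v ≟ n ⌋) (box n k))

Cm : Matrix
Cm n k = S n (suc k)

Λ : Matrix
Λ i j = if ⌊ i ≟ j ⌋ then 2 ^ i else 0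

P : Matrix
P n k = n C k

Pᵗ : Matrix
Pᵗ n k = P k n

Σ< : ℕ → (ℕ → ℕ) → ℕ
Σ< zero f = 0
Σ< (suc m) f = Σ< m f + f m

-- Product A·B·D of infinite matrices where A is lower triangular
-- (A n j = 0 for j > n), so the infinite sums over j and i are finite:
-- (A B D)(n,k) = Σ_{j ≤ n} Σ_{i ≤ n} A(n,j) B(j,i) D(i,k).
-- (B = Λ is diagonal, so only i = j contributes.)
triple : Matrix → Matrix → Matrix → Matrix
triple A B D n k = Σ< (suc n) (λ j → Σ< (suc n) (λ i → A n j * B j i * D i k))

L-S : Matrix
L-S zero zero = 1
L-S zero (suc k) = 0
L-S (suc n) zero = 0
L-S (suc n) (suc k) = n C k      -- n C k = 0 when k > n

-- L_C: (n,k) entry C(n,k) + C(n-1,k) for n ≥ k, with C(n-1,k) = 0 when n = 0;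
-- zero above the diagonal (automatic since binomials vanish there).
L-C : Matrix
L-C zero k = zero C k
L-C (suc n) k = (suc n) C k + n C k

{-# OPTIONS --safe #-}
-- Splitting off the first coordinate gives S(n,0) = [n = 0] and
-- S(n,k+1) = S(n,k) + 2 Σ_{i<n} S(i,k).  As Λ is diagonal, (L_S Λ Pᵗ)(n,k) = Σ_j L_S(n,j) 2^j C(k,j),
-- and Pascal's rule for 2^j C(k,j) in k, together with the hockey-stick identity
-- Σ_j L_S(n,j+1) x_j = Σ_{i<n} Σ_j L_S(i,j) x_j, shows that it satisfies the same recurrence.
-- Finally L_C(n,j) = L_S(n,j) + 2 L_S(n,j+1) is exactly that column step k ↦ k+1,
-- so L_C Λ Pᵗ is S with its columns shifted by one, i.e. C.
module Submission where

open import Defs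
open import Data.Nat using (ℕ; zero; suc; _+_; _*_; _^_; _∸_; _≤_; _<_; _≤′_; ≤′-refl; ≤′-step; _≟_; s≤s)
open import Data.Nat.Properties
open import Data.Nat.Combinatorics using (_C_; k>n⇒nCk≡0; nCk+nC[k+1]≡[n+1]C[k+1])
open import Data.Nat.ListAction using (sum)
open import Data.Nat.ListAction.Properties using (sum-++)
open import Data.Nat.Solver using (module +-*-Solver)
open import Data.Integer as ℤ using (∣_∣)
open import Data.List using (List; []; _∷_; _++_; map; concatMap; filterᵇ; length; upTo; downFrom; reverse)
open import Data.List.Properties using (filter-++; length-++; map-++; map-∘; map-cong; upTo-∷ʳ; reverse-upTo)
open import Data.Vec using (_∷_)
open import Data.Bool using (Bool; true; false)
open import Data.Product using (_×_; _,_)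
open import Function using (_∘_)
open import Relation.Nullary using (yes; no; contradiction)
open import Relation.Nullary.Decidable using (⌊_⌋)
open import Relation.Binary.PropositionalEquality
open +-*-Solver

Σ<-cong : ∀ n {f g : ℕ → ℕ} → (∀ i → i < n → f i ≡ g i) → Σ< n f ≡ Σ< n g
Σ<-cong zero    eq = refl
Σ<-cong (suc n) eq = cong₂ _+_ (Σ<-cong n (λ i i<n → eq i (m<n⇒m<1+n i<n))) (eq n (n<1+n n))

Σ<-zero : ∀ n {f : ℕ → ℕ} → (∀ i → i < n → f i ≡ 0) → Σ< n f ≡ 0
Σ<-zero zero    f≡0 = refl
Σ<-zero (suc n) f≡0 = cong₂ _+_ (Σ<-zero n (λ i i<n → f≡0 i (m<n⇒m<1+n i<n))) (f≡0 n (n<1+n n))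

Σ<-+ : ∀ n (f g : ℕ → ℕ) → Σ< n (λ i → f i + g i) ≡ Σ< n f + Σ< n g
Σ<-+ zero    f g = refl
Σ<-+ (suc n) f g rewrite Σ<-+ n f g =
  solve 4 (λ a b c d → (a :+ b) :+ (c :+ d) := (a :+ c) :+ (b :+ d)) refl (Σ< n f) (Σ< n g) (f n) (g n)

Σ<-*ˡ : ∀ n m (f : ℕ → ℕ) → Σ< n (λ i → m * f i) ≡ m * Σ< n f
Σ<-*ˡ zero    m f = sym (*-zeroʳ m)
Σ<-*ˡ (suc n) m f rewrite Σ<-*ˡ n m f = sym (*-distribˡ-+ m (Σ< n f) (f n))

Σ<-head : ∀ n (f : ℕ → ℕ) → Σ< (suc n) f ≡ f 0 + Σ< n (f ∘ suc)
Σ<-head zero    f = +-comm 0 (f 0)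
Σ<-head (suc n) f rewrite Σ<-head n f = +-assoc (f 0) _ _

Σ<-reverse : ∀ n (f : ℕ → ℕ) → Σ< n (λ i → f (n ∸ suc i)) ≡ Σ< n f
Σ<-reverse zero    f = refl
Σ<-reverse (suc n) f = begin
  Σ< (suc n) (λ i → f (suc n ∸ suc i))  ≡⟨ Σ<-head n (λ i → f (suc n ∸ suc i)) ⟩
  f n + Σ< n (λ i → f (n ∸ suc i))      ≡⟨ cong (f n +_) (Σ<-reverse n f) ⟩
  f n + Σ< n f                          ≡⟨ +-comm (f n) _ ⟩
  Σ< (suc n) f                          ∎
  where open ≡-Reasoning

Σ<-truncate : ∀ {t m} (f : ℕ → ℕ) → t ≤ m → (∀ i → t ≤ i → f i ≡ 0) → Σ< m f ≡ Σ< t f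
Σ<-truncate {t} f t≤m f≡0 = go (≤⇒≤′ t≤m)
  where
  go : ∀ {m} → t ≤′ m → Σ< m f ≡ Σ< t f
  go ≤′-refl        = refl
  go (≤′-step t≤′m) = trans (cong₂ _+_ (go t≤′m) (f≡0 _ (≤′⇒≤ t≤′m))) (+-identityʳ _)

Σ<-delta : ∀ {n j} (f : ℕ → ℕ) → j < n → (∀ i → i ≢ j → f i ≡ 0) → Σ< n f ≡ f j
Σ<-delta {n} {j} f j<n f≡0 = begin
  Σ< n f            ≡⟨ Σ<-truncate f j<n (λ i j<i → f≡0 i (>⇒≢ j<i)) ⟩
  Σ< j f + f j      ≡⟨ cong (_+ f j) (Σ<-zero j (λ i i<j → f≡0 i (<⇒≢ i<j))) ⟩
  f j               ∎
  where open ≡-Reasoning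

LowerTriangular : Matrix → Set
LowerTriangular A = ∀ {n j} → n < j → A n j ≡ 0

-- The product A B with the sum over j stopped at n: exact when A is lower triangular.
infixl 7 _·_
_·_ : Matrix → Matrix → Matrix
(A · B) n k = Σ< (suc n) (λ j → A n j * B j k)

rowSum-truncate : ∀ (A B : Matrix) n k {t m} → t ≤ m → (∀ {j} → t ≤ j → A n j ≡ 0) →
                  Σ< m (λ j → A n j * B j k) ≡ Σ< t (λ j → A n j * B j k)
rowSum-truncate A B n k t≤m A≡0 = Σ<-truncate _ t≤m (λ j t≤j → cong (_* B j k) (A≡0 t≤j))

shiftCols : Matrix → Matrix
shiftCols A n j = A n (suc j)

ΛPᵗ : Matrix
ΛPᵗ j k = 2 ^ j * (k C j)

Λ-offDiagonal : ∀ {i j} → i ≢ j → Λ i j ≡ 0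
Λ-offDiagonal {i} {j} i≢j with i ≟ j
... | yes i≡j = contradiction i≡j i≢j
... | no _    = refl

Λ-diagonal : ∀ j → Λ j j ≡ 2 ^ j
Λ-diagonal j with j ≟ j
... | yes _  = refl
... | no j≢j = contradiction refl j≢j

triple-Λ-Pᵗ : ∀ A n k → triple A Λ Pᵗ n k ≡ (A · ΛPᵗ) n k
triple-Λ-Pᵗ A n k = Σ<-cong (suc n) diagonalTerm
  where
  open ≡-Reasoning
  diagonalTerm : ∀ j → j < suc n → Σ< (suc n) (λ i → A n j * Λ j i * Pᵗ i k) ≡ A n j * ΛPᵗ j k
  diagonalTerm j j≤n = begin
    Σ< (suc n) (λ i → A n j * Λ j i * Pᵗ i k)  ≡⟨ Σ<-delta _ j≤n offDiagonal ⟩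
    A n j * Λ j j * (k C j)                     ≡⟨ cong (λ x → A n j * x * (k C j)) (Λ-diagonal j) ⟩
    A n j * 2 ^ j * (k C j)                     ≡⟨ *-assoc (A n j) _ _ ⟩
    A n j * ΛPᵗ j k                             ∎
    where
    offDiagonal : ∀ i → i ≢ j → A n j * Λ j i * Pᵗ i k ≡ 0
    offDiagonal i i≢j rewrite Λ-offDiagonal (i≢j ∘ sym) | *-zeroʳ (A n j) = refl

ΛPᵗ-pascal : ∀ j k → ΛPᵗ (suc j) (suc k) ≡ ΛPᵗ (suc j) k + 2 * ΛPᵗ j k
ΛPᵗ-pascal j k rewrite sym (nCk+nC[k+1]≡[n+1]C[k+1] k j) =
  solve 3 (λ p x y → (con 2 :* p) :* (x :+ y) := (con 2 :* p) :* y :+ con 2 :* (p :* x))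
        refl (2 ^ j) (k C j) (k C suc j)

L-S-lower : LowerTriangular L-S
L-S-lower {zero}  {suc j} _         = refl
L-S-lower {suc n} {suc j} (s≤s n<j) = k>n⇒nCk≡0 n<j

L-S-pascal : ∀ n j → L-S (suc n) (suc j) ≡ L-S n (suc j) + L-S n j
L-S-pascal zero    zero    = refl
L-S-pascal zero    (suc j) = refl
L-S-pascal (suc n) zero    = refl
L-S-pascal (suc n) (suc j) = trans (sym (nCk+nC[k+1]≡[n+1]C[k+1] n j)) (+-comm (n C j) _)

L-C≡L-S+2shiftL-S : ∀ n j → L-C n j ≡ L-S n j + 2 * shiftCols L-S n j
L-C≡L-S+2shiftL-S zero    zero    = refl
L-C≡L-S+2shiftL-S zero    (suc j) = refl
L-C≡L-S+2shiftL-S (suc n) zero    = refl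
L-C≡L-S+2shiftL-S (suc n) (suc j) rewrite sym (nCk+nC[k+1]≡[n+1]C[k+1] n j) =
  solve 2 (λ x y → (x :+ y) :+ y := x :+ con 2 :* y) refl (n C j) (n C suc j)

ΛPᵗ-col0 : ∀ j → ΛPᵗ (suc j) 0 ≡ 0
ΛPᵗ-col0 j = *-zeroʳ (2 ^ suc j)

·ΛPᵗ-sucCol : ∀ {A} → LowerTriangular A → ∀ n k →
              (A · ΛPᵗ) n (suc k) ≡ (A · ΛPᵗ) n k + 2 * (shiftCols A · ΛPᵗ) n k
·ΛPᵗ-sucCol {A} A-lower n k = begin
  (A · ΛPᵗ) n (suc k)
    ≡⟨ Σ<-head n _ ⟩
  A n 0 * 1 + Σ< n (λ j → A n (suc j) * ΛPᵗ (suc j) (suc k))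
    ≡⟨ cong (A n 0 * 1 +_) (Σ<-cong n (λ j _ → splitTerm j)) ⟩
  A n 0 * 1 + Σ< n (λ j → A n (suc j) * ΛPᵗ (suc j) k + 2 * (A n (suc j) * ΛPᵗ j k))
    ≡⟨ cong (A n 0 * 1 +_) (trans (Σ<-+ n _ _) (cong (X +_) (Σ<-*ˡ n 2 _))) ⟩
  A n 0 * 1 + (X + 2 * Σ< n (λ j → shiftCols A n j * ΛPᵗ j k))
    ≡⟨ +-assoc (A n 0 * 1) X _ ⟨
  (A n 0 * 1 + X) + 2 * Σ< n (λ j → shiftCols A n j * ΛPᵗ j k)
    ≡⟨ cong₂ (λ u v → u + 2 * v) (Σ<-head n _) (rowSum-truncate (shiftCols A) ΛPᵗ n k (n≤1+n n) (A-lower ∘ s≤s)) ⟨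
  (A · ΛPᵗ) n k + 2 * (shiftCols A · ΛPᵗ) n k
    ∎
  where
  open ≡-Reasoning
  X : ℕ
  X = Σ< n (λ j → A n (suc j) * ΛPᵗ (suc j) k)
  splitTerm : ∀ j → A n (suc j) * ΛPᵗ (suc j) (suc k) ≡ A n (suc j) * ΛPᵗ (suc j) k + 2 * (A n (suc j) * ΛPᵗ j k)
  splitTerm j rewrite ΛPᵗ-pascal j k =
    solve 3 (λ a x y → a :* (x :+ con 2 :* y) := a :* x :+ con 2 :* (a :* y)) refl (A n (suc j)) (ΛPᵗ (suc j) k) (ΛPᵗ j k)

shiftL-S·≡partialSums : ∀ B n k → (shiftCols L-S · B) n k ≡ Σ< n (λ i → (L-S · B) i k)
shiftL-S·≡partialSums B zero    k = refl
shiftL-S·≡partialSums B (suc n) k = begin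
  (shiftCols L-S · B) (suc n) k
    ≡⟨ Σ<-cong (suc (suc n)) (λ j _ → trans (cong (_* B j k) (L-S-pascal n j)) (*-distribʳ-+ (B j k) (L-S n (suc j)) (L-S n j))) ⟩
  Σ< (suc (suc n)) (λ j → L-S n (suc j) * B j k + L-S n j * B j k)
    ≡⟨ Σ<-+ (suc (suc n)) (λ j → L-S n (suc j) * B j k) (λ j → L-S n j * B j k) ⟩
  Σ< (suc (suc n)) (λ j → shiftCols L-S n j * B j k) + Σ< (suc (suc n)) (λ j → L-S n j * B j k)
    ≡⟨ cong₂ _+_ (rowSum-truncate (shiftCols L-S) B n k (n≤1+n (suc n)) (L-S-lower ∘ m≤n⇒m≤1+n))
                 (rowSum-truncate L-S B n k (n≤1+n (suc n)) L-S-lower) ⟩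
  (shiftCols L-S · B) n k + (L-S · B) n k
    ≡⟨ cong (_+ (L-S · B) n k) (shiftL-S·≡partialSums B n k) ⟩
  Σ< (suc n) (λ i → (L-S · B) i k)
    ∎
  where open ≡-Reasoning

L-C·≡L-S·+2shiftL-S· : ∀ B n k → (L-C · B) n k ≡ (L-S · B) n k + 2 * (shiftCols L-S · B) n k
L-C·≡L-S·+2shiftL-S· B n k = begin
  (L-C · B) n k
    ≡⟨ Σ<-cong (suc n) (λ j _ → trans (cong (_* B j k) (L-C≡L-S+2shiftL-S n j)) (distrib j)) ⟩
  Σ< (suc n) (λ j → L-S n j * B j k + 2 * (shiftCols L-S n j * B j k))
    ≡⟨ trans (Σ<-+ (suc n) (λ j → L-S n j * B j k) _) (cong ((L-S · B) n k +_) (Σ<-*ˡ (suc n) 2 _)) ⟩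
  (L-S · B) n k + 2 * (shiftCols L-S · B) n k
    ∎
  where
  open ≡-Reasoning
  distrib : ∀ j → (L-S n j + 2 * L-S n (suc j)) * B j k ≡ L-S n j * B j k + 2 * (L-S n (suc j) * B j k)
  distrib j = solve 3 (λ a b x → (a :+ con 2 :* b) :* x := a :* x :+ con 2 :* (b :* x)) refl (L-S n j) (L-S n (suc j)) (B j k)

sphere : ℕ → ℕ → ℕ
sphere n       (suc k) = sphere n k + 2 * Σ< n (λ i → sphere i k)
sphere zero    zero    = 1
sphere (suc n) zero    = 0

sphere≡L-S·ΛPᵗ : ∀ n k → sphere n k ≡ (L-S · ΛPᵗ) n k
sphere≡L-S·ΛPᵗ n       (suc k) = begin
  sphere n k + 2 * Σ< n (λ i → sphere i k)
    ≡⟨ cong₂ (λ a b → a + 2 * b) (sphere≡L-S·ΛPᵗ n k) (Σ<-cong n (λ i _ → sphere≡L-S·ΛPᵗ i k)) ⟩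
  (L-S · ΛPᵗ) n k + 2 * Σ< n (λ i → (L-S · ΛPᵗ) i k)
    ≡⟨ cong (λ b → (L-S · ΛPᵗ) n k + 2 * b) (shiftL-S·≡partialSums ΛPᵗ n k) ⟨
  (L-S · ΛPᵗ) n k + 2 * (shiftCols L-S · ΛPᵗ) n k
    ≡⟨ ·ΛPᵗ-sucCol L-S-lower n k ⟨
  (L-S · ΛPᵗ) n (suc k)
    ∎
  where open ≡-Reasoning
sphere≡L-S·ΛPᵗ zero    zero    = refl
sphere≡L-S·ΛPᵗ (suc n) zero    = sym (Σ<-zero (suc (suc n)) vanish)
  where
  vanish : ∀ j → j < suc (suc n) → L-S (suc n) j * ΛPᵗ j 0 ≡ 0
  vanish zero    _ = refl
  vanish (suc j) _ = trans (cong (L-S (suc n) (suc j) *_) (ΛPᵗ-col0 j)) (*-zeroʳ (L-S (suc n) (suc j)))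

countᵇ : {A : Set} → (A → Bool) → List A → ℕ
countᵇ p xs = length (filterᵇ p xs)

module _ {A : Set} where

  countᵇ-++ : ∀ (p : A → Bool) xs ys → countᵇ p (xs ++ ys) ≡ countᵇ p xs + countᵇ p ys
  countᵇ-++ p xs ys = trans (cong length (filter-++ _ xs ys)) (length-++ (filterᵇ p xs))

  countᵇ-cong : ∀ {p q : A → Bool} → (∀ x → p x ≡ q x) → ∀ xs → countᵇ p xs ≡ countᵇ q xs
  countᵇ-cong         p≡q []       = refl
  countᵇ-cong {p} {q} p≡q (x ∷ xs) with p x | q x | p≡q x
  ... | true  | .true  | refl = cong suc (countᵇ-cong p≡q xs)
  ... | false | .false | refl = countᵇ-cong p≡q xs

  countᵇ-none : ∀ {p : A → Bool} → (∀ x → p x ≡ false) → ∀ xs → countᵇ p xs ≡ 0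
  countᵇ-none         p≡false []       = refl
  countᵇ-none {p} p≡false (x ∷ xs) with p x | p≡false x
  ... | .false | refl = countᵇ-none p≡false xs

  countᵇ-concatMap : ∀ {B : Set} (p : A → Bool) (F : B → List A) xs →
                     countᵇ p (concatMap F xs) ≡ sum (map (countᵇ p ∘ F) xs)
  countᵇ-concatMap p F []       = refl
  countᵇ-concatMap p F (x ∷ xs) =
    trans (countᵇ-++ p (F x) (concatMap F xs)) (cong (countᵇ p (F x) +_) (countᵇ-concatMap p F xs))

countᵇ-map : ∀ {A B : Set} (p : B → Bool) (h : A → B) xs → countᵇ p (map h xs) ≡ countᵇ (p ∘ h) xs
countᵇ-map p h []       = refl
countᵇ-map p h (x ∷ xs) with p (h x)
... | true  = cong suc (countᵇ-map p h xs)
... | false = countᵇ-map p h xs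

sum-map-upTo : ∀ (f : ℕ → ℕ) n → sum (map f (upTo n)) ≡ Σ< n f
sum-map-upTo f zero    = refl
sum-map-upTo f (suc n) = begin
  sum (map f (upTo (suc n)))          ≡⟨ cong (sum ∘ map f) (upTo-∷ʳ n) ⟨
  sum (map f (upTo n ++ n ∷ []))      ≡⟨ cong sum (map-++ f (upTo n) (n ∷ [])) ⟩
  sum (map f (upTo n) ++ f n ∷ [])    ≡⟨ sum-++ (map f (upTo n)) (f n ∷ []) ⟩
  sum (map f (upTo n)) + (f n + 0)    ≡⟨ cong₂ _+_ (sum-map-upTo f n) (+-identityʳ (f n)) ⟩
  Σ< (suc n) f                        ∎
  where open ≡-Reasoning

sum-map-downFrom : ∀ (f : ℕ → ℕ) n → sum (map f (downFrom n)) ≡ Σ< n f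
sum-map-downFrom f zero    = refl
sum-map-downFrom f (suc n) = trans (cong (f n +_) (sum-map-downFrom f n)) (+-comm (f n) _)

sum-range : ∀ (f : ℕ → ℕ) m → sum (map (f ∘ ∣_∣) (range m)) ≡ f 0 + 2 * Σ< m (f ∘ suc)
sum-range f m = begin
  sum (map (f ∘ ∣_∣) (range m))
    ≡⟨ cong sum (map-++ (f ∘ ∣_∣) negatives (map ℤ.+_ (upTo (suc m)))) ⟩
  sum (map (f ∘ ∣_∣) negatives ++ map (f ∘ ∣_∣) (map ℤ.+_ (upTo (suc m))))
    ≡⟨ sum-++ (map (f ∘ ∣_∣) negatives) _ ⟩
  sum (map (f ∘ ∣_∣) negatives) + sum (map (f ∘ ∣_∣) (map ℤ.+_ (upTo (suc m))))
    ≡⟨ cong₂ (λ xs ys → sum xs + sum ys) (trans (sym (map-∘ (reverse (upTo m)))) (cong (map (f ∘ suc)) (reverse-upTo m)))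
                                         (sym (map-∘ (upTo (suc m)))) ⟩
  sum (map (f ∘ suc) (downFrom m)) + sum (map f (upTo (suc m)))
    ≡⟨ cong₂ _+_ (sum-map-downFrom (f ∘ suc) m) (trans (sum-map-upTo f (suc m)) (Σ<-head m f)) ⟩
  Σ< m (f ∘ suc) + (f 0 + Σ< m (f ∘ suc))
    ≡⟨ solve 2 (λ s a → s :+ (a :+ s) := a :+ con 2 :* s) refl (Σ< m (f ∘ suc)) (f 0) ⟩
  f 0 + 2 * Σ< m (f ∘ suc)
    ∎
  where
  open ≡-Reasoning
  negatives = map (λ i → ℤ.- (ℤ.+ suc i)) (reverse (upTo m))

offset-≟ : ∀ {i t} a → i ≤ t → ⌊ i + a ≟ t ⌋ ≡ ⌊ a ≟ t ∸ i ⌋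
offset-≟ {i} {t} a i≤t with i + a ≟ t | a ≟ t ∸ i
... | yes _        | yes _        = refl
... | no  _        | no  _        = refl
... | yes i+a≡t    | no  a≢t∸i    = contradiction (trans (sym (m+n∸m≡n i a)) (cong (_∸ i) i+a≡t)) a≢t∸i
... | no  i+a≢t    | yes a≡t∸i    = contradiction (trans (cong (i +_) a≡t∸i) (m+[n∸m]≡n i≤t)) i+a≢t

offset-≟-false : ∀ {i t} a → t < i → ⌊ i + a ≟ t ⌋ ≡ false
offset-≟-false {i} {t} a t<i with i + a ≟ t
... | yes i+a≡t = contradiction (subst (i ≤_) i+a≡t (m≤m+n i a)) (<⇒≱ t<i)
... | no  _     = refl

box-count : ∀ {m t} k → t ≤ m → countᵇ (λ v → ⌊ absSum v ≟ t ⌋) (box m k) ≡ sphere t k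
box-count {t = zero}  zero    _   = refl
box-count {t = suc t} zero    _   = refl
box-count {m} {t}     (suc k) t≤m = begin
  countᵇ (λ v → ⌊ absSum v ≟ t ⌋) (box m (suc k))
    ≡⟨ countᵇ-concatMap _ (λ x → map (x ∷_) (box m k)) (range m) ⟩
  sum (map (λ x → countᵇ (λ v → ⌊ absSum v ≟ t ⌋) (map (x ∷_) (box m k))) (range m))
    ≡⟨ cong sum (map-cong (λ x → countᵇ-map _ (x ∷_) (box m k)) (range m)) ⟩
  sum (map (completions ∘ ∣_∣) (range m))
    ≡⟨ sum-range completions m ⟩
  completions 0 + 2 * Σ< m (completions ∘ suc)
    ≡⟨ cong₂ (λ a b → a + 2 * b) (box-count k t≤m) tail ⟩
  sphere t k + 2 * Σ< t (λ i → sphere i k)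
    ∎
  where
  open ≡-Reasoning
  completions : ℕ → ℕ
  completions i = countᵇ (λ v → ⌊ i + absSum v ≟ t ⌋) (box m k)

  tail : Σ< m (completions ∘ suc) ≡ Σ< t (λ i → sphere i k)
  tail = begin
    Σ< m (completions ∘ suc)
      ≡⟨ Σ<-truncate _ t≤m (λ i t≤i → countᵇ-none (λ v → offset-≟-false (absSum v) (s≤s t≤i)) (box m k)) ⟩
    Σ< t (completions ∘ suc)
      ≡⟨ Σ<-cong t (λ i i<t → trans (countᵇ-cong (λ v → offset-≟ (absSum v) i<t) (box m k))
                                     (box-count k (≤-trans (m∸n≤m t (suc i)) t≤m))) ⟩
    Σ< t (λ i → sphere (t ∸ suc i) k)
      ≡⟨ Σ<-reverse t (λ i → sphere i k) ⟩
    Σ< t (λ i → sphere i k)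
      ∎

S≡L-S·ΛPᵗ : ∀ n k → S n k ≡ (L-S · ΛPᵗ) n k
S≡L-S·ΛPᵗ n k = trans (box-count k ≤-refl) (sphere≡L-S·ΛPᵗ n k)

mainTheorem19 : (∀ n k → S n k ≡ triple L-S Λ Pᵗ n k)
              × (∀ n k → Cm n k ≡ triple L-C Λ Pᵗ n k)
mainTheorem19 = (λ n k → trans (S≡L-S·ΛPᵗ n k) (sym (triple-Λ-Pᵗ L-S n k)))
              , Cm≡triple
  where
  Cm≡triple : ∀ n k → Cm n k ≡ triple L-C Λ Pᵗ n k
  Cm≡triple n k = begin
    S n (suc k)                                       ≡⟨ S≡L-S·ΛPᵗ n (suc k) ⟩
    (L-S · ΛPᵗ) n (suc k)                             ≡⟨ ·ΛPᵗ-sucCol L-S-lower n k ⟩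
    (L-S · ΛPᵗ) n k + 2 * (shiftCols L-S · ΛPᵗ) n k   ≡⟨ L-C·≡L-S·+2shiftL-S· ΛPᵗ n k ⟨
    (L-C · ΛPᵗ) n k                                   ≡⟨ triple-Λ-Pᵗ L-C n k ⟨
    triple L-C Λ Pᵗ n k                               ∎
    where open ≡-Reasoning
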